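{- For every $n\in\mathbb{Z}^+$, the $\ell$-pregroup $\mathbf{F}_n(\mathbb{Z})$ is simple.
   Context: $\mathbf{F}_n(\mathbb{Z})$ is the set of maps $f$ on $\mathbb{Z}$ having residuals ($f^r(b)=\max\{a:f(a)\le b\}$) and dual residuals ($f^\ell(a)=\min\{b:a\le f(b)\}$) of all orders and satisfying $f^{\ell^n}=f^{r^n}$, an $\ell$-pregroup (lattice-ordered monoid with $x^\ell x\le1\le xx^\ell$, $xx^r\le1\le x^rx$) under composition, identity, pointwise order, ${}^\ell$ and ${}^r$. Simple means it has exactly two congruences. -}

module Defs where

open import Data.Nat using (ℕ; zero; suc)
open import Data.Integer using (ℤ; _≤_; _⊓_; _⊔_)
open import Data.Product using (_×_; ∃-syntax)
open import Data.Sum using (_⊎_)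
open import Relation.Binary.PropositionalEquality using (_≡_)
open import Relation.Nullary using (¬_)

OrderPreserving : (ℤ → ℤ) → Set
OrderPreserving f = ∀ a b → a ≤ b → f a ≤ f b

IsResidual : (ℤ → ℤ) → (ℤ → ℤ) → Set
IsResidual f g = ∀ b → (f (g b) ≤ b) × (∀ a → f a ≤ b → a ≤ g b)

IsDualResidual : (ℤ → ℤ) → (ℤ → ℤ) → Set
IsDualResidual f g = ∀ a → (a ≤ f (g a)) × (∀ b → a ≤ f b → g a ≤ b)

iter : (ℤ → ℤ) → (ℕ → ℤ → ℤ) → ℕ → ℤ → ℤ
iter f s zero    = f
iter f s (suc k) = s k

-- Elements of F_n(ℤ): (order-preserving) maps f on ℤ having residuals and
-- dual residuals of all orders, with f^{ℓ^n} = f^{r^n}.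
-- rs k is f^{r^(k+1)} and ls k is f^{ℓ^(k+1)} (unique when they exist).
record Fn (n : ℕ) : Set where
  field
    fun      : ℤ → ℤ
    mono     : OrderPreserving fun
    rs       : ℕ → ℤ → ℤ
    ls       : ℕ → ℤ → ℤ
    rs-res   : ∀ k → IsResidual (iter fun rs k) (rs k)
    ls-res   : ∀ k → IsDualResidual (iter fun ls k) (ls k)
    balanced : ∀ x → iter fun ls n x ≡ iter fun rs n x

open Fn public

_≈_ : ∀ {n} → Fn n → Fn n → Set
f ≈ g = ∀ x → fun f x ≡ fun g x

-- Compatibility is stated relationally: the result of an operation is any
-- element whose underlying map is the pointwise result (F_n(ℤ) is closed
-- under the operations, so this is the usual compatibility condition).
-- The identity constant imposes no condition.
record IsCongruence {n : ℕ} (θ : Fn n → Fn n → Set) : Set where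
  field
    reflexive : ∀ f g → f ≈ g → θ f g
    symmetric : ∀ f g → θ f g → θ g f
    transitive : ∀ f g h → θ f g → θ g h → θ f h
    compat-∘ : ∀ f f′ g g′ h h′ → θ f f′ → θ g g′ →
               (∀ x → fun h x ≡ fun f (fun g x)) →
               (∀ x → fun h′ x ≡ fun f′ (fun g′ x)) → θ h h′
    compat-∧ : ∀ f f′ g g′ h h′ → θ f f′ → θ g g′ →
               (∀ x → fun h x ≡ fun f x ⊓ fun g x) →
               (∀ x → fun h′ x ≡ fun f′ x ⊓ fun g′ x) → θ h h′
    compat-∨ : ∀ f f′ g g′ h h′ → θ f f′ → θ g g′ →
               (∀ x → fun h x ≡ fun f x ⊔ fun g x) →
               (∀ x → fun h′ x ≡ fun f′ x ⊔ fun g′ x) → θ h h′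
    compat-ℓ : ∀ f f′ h h′ → θ f f′ →
               (∀ x → fun h x ≡ ls f 0 x) →
               (∀ x → fun h′ x ≡ ls f′ 0 x) → θ h h′
    compat-r : ∀ f f′ h h′ → θ f f′ →
               (∀ x → fun h x ≡ rs f 0 x) →
               (∀ x → fun h′ x ≡ rs f′ 0 x) → θ h h′

-- Simple: exactly two congruences, the identity Δ (= _≈_) and the total ∇,
-- and these differ.  The dichotomy is stated double-negated (constructive
-- rendering of the classical "θ = Δ or θ = ∇").
Simple : (n : ℕ) → Set₁
Simple n =
  (∃[ f ] ∃[ g ] ¬ (_≈_ {n} f g)) ×
  (∀ (θ : Fn n → Fn n → Set) → IsCongruence θ →
     ¬ ¬ ((∀ f g → θ f g → f ≈ g) ⊎ (∀ f g → θ f g)))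

-- Every f ∈ F_n(ℤ) commutes with the translation x ↦ n + x.  On ℤ the dual residual of a map is its
-- residual conjugated by x ↦ 1 + x, so f^{ℓ^j} is f^{r^j} conjugated by x ↦ j + x; the balance
-- f^{ℓ^n} = f^{r^n} therefore makes f^{r^n} commute with x ↦ n + x, and this passes down the residual
-- chain to f.  Hence every element lies between two translations.
--
-- Now let a congruence θ identify f and g with g x₀ < f x₀.  Then (g^ℓ ∘ f) ∨ id is θ-related to
-- (g^ℓ ∘ g) ∨ id = id and moves x₀ up; the join of its conjugates by the translations 0, …, n - 1 moves
-- every point up, so its powers dominate every translation by a natural number.  Since θ-classes are
-- convex, all translations, and then all elements, fall into the class of id.

module Submission where

open import Defs
open import Data.Bool using (Bool; true; false; not)
open import Data.Bool.Properties using (not-involutive)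
open import Data.Integer.Base
  using (ℤ; +_; -[1+_]; -_; _+_; _-_; _*_; _⊓_; _⊔_; 0ℤ; 1ℤ; +≤+)
  renaming (_≤_ to _≤ᶻ_; _<_ to _<ᶻ_)
open import Data.Integer.Properties
  using ( ≤-refl; ≤-trans; ≤-antisym; ≤-reflexive; <-irrefl; ≰⇒>; <⇒≱; i<j⇒suc[i]≤j; suc[i]≤j⇒i<j
        ; <-cmp; _≟_; +-monoʳ-≤; +-monoˡ-≤; +-identityˡ; +-identityʳ; +-assoc; i≤j+i; i≤j⇒i-j≤0
        ; neg-distribˡ-*; i⊓j≤i; i⊓j≤j; i≤i⊔j; i≤j⊔i; ⊔-lub; ⊓-glb; i⊔j≤k⇒i≤k; i⊔j≤k⇒j≤k
        ; ⊔-sel; ⊓-sel; i≤j⇒i⊓k≤j; i≤j⇒k⊓i≤j; i≤j⇒i≤j⊔k; i≤j⇒i≤k⊔j; ⊔-mono-≤; ⊓-mono-≤; ⊔-idem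
        ; i≤j⇒i⊔j≡j; i≥j⇒i⊔j≡i
        ; module ≤-Reasoning )
open import Data.Integer.DivMod using (_/ℕ_; _%ℕ_; a≡a%ℕn+[a/ℕn]*n; n%ℕd<d)
open import Data.Integer.Tactic.RingSolver using (solve-∀)
open import Data.Nat.Base using (ℕ; zero; suc; _≤_; z≤n; s≤s⁻¹)
import Data.Nat.Properties as ℕ
open import Data.Product using (_×_; _,_; proj₁; proj₂; ∃-syntax)
open import Data.Sum using (_⊎_; inj₁; inj₂)
open import Data.Empty using (⊥-elim)
open import Relation.Nullary using (¬_; yes; no)
open import Relation.Binary.Definitions using (tri<; tri≈; tri>)
open import Relation.Binary.PropositionalEquality

private
  variable
    n : ℕ
    A B C A′ : ℤ → ℤ

neg-+-cancel : ∀ c x → - c + (c + x) ≡ x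
neg-+-cancel = solve-∀

+-neg-cancel : ∀ c x → c + (- c + x) ≡ x
+-neg-cancel = solve-∀

+-cancelˡ-≤ : ∀ c {a b} → c + a ≤ᶻ c + b → a ≤ᶻ b
+-cancelˡ-≤ c {a} {b} le = subst₂ _≤ᶻ_ (neg-+-cancel c a) (neg-+-cancel c b) (+-monoʳ-≤ (- c) le)

suc≰ : ∀ x → ¬ (1ℤ + x ≤ᶻ x)
suc≰ x le = <-irrefl refl (suc[i]≤j⇒i<j le)

≰⇒suc≤ : ∀ {a b} → ¬ (a ≤ᶻ b) → 1ℤ + b ≤ᶻ a
≰⇒suc≤ a≰b = i<j⇒suc[i]≤j (≰⇒> a≰b)

residual-mono : IsResidual A B → OrderPreserving B
residual-mono {A} {B} res a b a≤b = proj₂ (res b) (B a) (≤-trans (proj₁ (res a)) a≤b)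

dualResidual-mono : IsDualResidual A C → OrderPreserving C
dualResidual-mono {A} {C} dres a b a≤b = proj₂ (dres a) (C b) (≤-trans a≤b (proj₁ (dres b)))

dualResidual⇒residual : OrderPreserving A → IsDualResidual A C → IsResidual C A
dualResidual⇒residual {A} mA dres b =
  proj₂ (dres (A b)) b ≤-refl , λ a Ca≤b → ≤-trans (proj₁ (dres a)) (mA _ _ Ca≤b)

residual⇒dualResidual : OrderPreserving A → IsResidual A B → IsDualResidual B A
residual⇒dualResidual {A} mA res a =
  proj₂ (res (A a)) a ≤-refl , λ b a≤Bb → ≤-trans (mA _ _ a≤Bb) (proj₁ (res b))

dualResidual-unique : IsDualResidual A B → IsDualResidual A C → B ≗ C
dualResidual-unique {A} {B} {C} dB dC x =
  ≤-antisym (proj₂ (dB x) (C x) (proj₁ (dC x))) (proj₂ (dC x) (B x) (proj₁ (dB x)))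

dualResidual-resp-≗ : A ≗ A′ → IsDualResidual A C → IsDualResidual A′ C
dualResidual-resp-≗ {A} {A′} {C} A≗A′ dres a =
  subst (a ≤ᶻ_) (A≗A′ (C a)) (proj₁ (dres a)) ,
  λ b a≤A′b → proj₂ (dres a) b (subst (a ≤ᶻ_) (sym (A≗A′ b)) a≤A′b)

TranslatedBy : ℤ → (ℤ → ℤ) → (ℤ → ℤ) → Set
TranslatedBy c A A′ = ∀ x → A′ (c + x) ≡ c + A x

Periodic : ℤ → (ℤ → ℤ) → Set
Periodic p f = TranslatedBy p f f

-- On ℤ, x ≤ A b fails exactly when A b ≤ x - 1, i.e. when b ≤ A^r (x - 1); so A^ℓ (1 + y) = 1 + A^r y.
dualResidual-translatedBy : ∀ c → OrderPreserving A → IsResidual A B → IsDualResidual A′ C →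
                            TranslatedBy c A A′ → TranslatedBy (1ℤ + c) B C
dualResidual-translatedBy {A} {B} {A′} {C} c mA res dres A~A′ y = ≤-antisym upper lower
  where
  open ≤-Reasoning
  shuffle : ∀ u → 1ℤ + c + u ≡ c + (1ℤ + u)
  shuffle = solve-∀

  y<A[1+By] : 1ℤ + y ≤ᶻ A (1ℤ + B y)
  y<A[1+By] = ≰⇒suc≤ (λ A≤y → suc≰ (B y) (proj₂ (res y) _ A≤y))

  upper : C (1ℤ + c + y) ≤ᶻ 1ℤ + c + B y
  upper = proj₂ (dres _) _ (begin
    1ℤ + c + y           ≡⟨ shuffle y ⟩
    c + (1ℤ + y)         ≤⟨ +-monoʳ-≤ c y<A[1+By] ⟩
    c + A (1ℤ + B y)     ≡⟨ A~A′ _ ⟨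
    A′ (c + (1ℤ + B y))  ≡⟨ cong A′ (shuffle (B y)) ⟨
    A′ (1ℤ + c + B y)    ∎)

  b = C (1ℤ + c + y)
  y<A[b-c] : 1ℤ + y ≤ᶻ A (- c + b)
  y<A[b-c] = +-cancelˡ-≤ c (begin
    c + (1ℤ + y)       ≡⟨ shuffle y ⟨
    1ℤ + c + y         ≤⟨ proj₁ (dres _) ⟩
    A′ b               ≡⟨ cong A′ (+-neg-cancel c b) ⟨
    A′ (c + (- c + b)) ≡⟨ A~A′ _ ⟩
    c + A (- c + b)    ∎)

  lower : 1ℤ + c + B y ≤ᶻ b
  lower = begin
    1ℤ + c + B y         ≡⟨ shuffle (B y) ⟩
    c + (1ℤ + B y)       ≤⟨ +-monoʳ-≤ c (≰⇒suc≤ λ b-c≤By →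
                              suc≰ y (≤-trans y<A[b-c] (≤-trans (mA _ _ b-c≤By) (proj₁ (res y))))) ⟩
    c + (- c + b)        ≡⟨ +-neg-cancel c b ⟩
    b                    ∎

res^ dual^ : Fn n → ℕ → ℤ → ℤ
res^ F = iter (fun F) (rs F)
dual^ F = iter (fun F) (ls F)

res^-mono : (F : Fn n) → ∀ j → OrderPreserving (res^ F j)
res^-mono F zero    = mono F
res^-mono F (suc j) = residual-mono (rs-res F j)

dual^-translatedBy-res^ : (F : Fn n) → ∀ j → TranslatedBy (+ j) (res^ F j) (dual^ F j)
dual^-translatedBy-res^ F zero x = trans (cong (fun F) (+-identityˡ x)) (sym (+-identityˡ _))
dual^-translatedBy-res^ F (suc j) =
  dualResidual-translatedBy (+ j) (res^-mono F j) (rs-res F j) (ls-res F j) (dual^-translatedBy-res^ F j)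

periodic-residual⇒periodic : ∀ {p} → OrderPreserving A → IsResidual A B → Periodic p B → Periodic p A
periodic-residual⇒periodic {A} {B} {p} mA res perB a = ≤-antisym upper lower
  where
  open ≤-Reasoning
  upper : A (p + a) ≤ᶻ p + A a
  upper = ≤-trans (mA _ _ (begin
    p + a          ≤⟨ +-monoʳ-≤ p (proj₂ (res (A a)) a ≤-refl) ⟩
    p + B (A a)    ≡⟨ perB (A a) ⟨
    B (p + A a)    ∎)) (proj₁ (res _))

  w = A (p + a)
  a≤B[w-p] : a ≤ᶻ B (- p + w)
  a≤B[w-p] = +-cancelˡ-≤ p (begin
    p + a              ≤⟨ proj₂ (res w) _ ≤-refl ⟩
    B w                ≡⟨ cong B (+-neg-cancel p w) ⟨
    B (p + (- p + w))  ≡⟨ perB _ ⟩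
    p + B (- p + w)    ∎)

  lower : p + A a ≤ᶻ w
  lower = begin
    p + A a            ≤⟨ +-monoʳ-≤ p (≤-trans (mA _ _ a≤B[w-p]) (proj₁ (res _))) ⟩
    p + (- p + w)      ≡⟨ +-neg-cancel p w ⟩
    w                  ∎

Fn-periodic : (F : Fn n) → Periodic (+ n) (fun F)
Fn-periodic {n} F = descend n res^ₙ-periodic
  where
  res^ₙ-periodic : Periodic (+ n) (res^ F n)
  res^ₙ-periodic x = trans (sym (balanced F (+ n + x))) (dual^-translatedBy-res^ F n x)

  descend : ∀ j → Periodic (+ n) (res^ F j) → Periodic (+ n) (fun F)
  descend zero    per = per
  descend (suc j) per = descend j (periodic-residual⇒periodic {p = + n} (res^-mono F j) (rs-res F j) per)

periodic-zero : ∀ (f : ℤ → ℤ) → Periodic 0ℤ f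
periodic-zero f x = trans (cong f (+-identityˡ x)) (sym (+-identityˡ (f x)))

periodic-neg : ∀ {p f} → Periodic p f → Periodic (- p) f
periodic-neg {p} {f} per x = begin
  f (- p + x)             ≡⟨ neg-+-cancel p _ ⟨
  - p + (p + f (- p + x)) ≡⟨ cong (_+_ (- p)) (per (- p + x)) ⟨
  - p + f (p + (- p + x)) ≡⟨ cong (λ y → - p + f y) (+-neg-cancel p x) ⟩
  - p + f x               ∎
  where open ≡-Reasoning

periodic-+ : ∀ {p f q} → Periodic p f → Periodic q f → Periodic (p + q) f
periodic-+ {p} {f} {q} perp perq x = begin
  f (p + q + x)   ≡⟨ cong f (+-assoc p q x) ⟩
  f (p + (q + x)) ≡⟨ perp (q + x) ⟩
  p + f (q + x)   ≡⟨ cong (_+_ p) (perq x) ⟩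
  p + (q + f x)   ≡⟨ +-assoc p q (f x) ⟨
  p + q + f x     ∎
  where open ≡-Reasoning

periodic-* : ∀ {p f} → Periodic p f → ∀ q → Periodic (q * p) f
periodic-* {p} {f} per (+ k)    = multiple k
  where
  multiple : ∀ k → Periodic (+ k * p) f
  multiple zero    = periodic-zero f
  multiple (suc k) = subst (λ q → Periodic q f) (distrib p (+ k)) (periodic-+ {p} {f} per (multiple k))
    where
    distrib : ∀ p k → p + k * p ≡ (1ℤ + k) * p
    distrib = solve-∀
periodic-* {p} {f} per -[1+ k ] =
  subst (λ q → Periodic q f) (neg-distribˡ-* (+ suc k) p)
        (periodic-neg {+ suc k * p} {f} (periodic-* {p} {f} per (+ suc k)))

residue-offset : ∀ m x₀ x → ∃[ i ] ∃[ q ] (i ≤ m × + i + x ≡ q * + suc m + x₀)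
residue-offset m x₀ x = i , - q , s≤s⁻¹ (n%ℕd<d e (suc m)) , (begin
  + i + x                      ≡⟨ expand (+ i) (q * p) x ⟩
  + i + q * p - q * p + x      ≡⟨ cong (λ e → e - q * p + x) (a≡a%ℕn+[a/ℕn]*n e (suc m)) ⟨
  x₀ - x - q * p + x           ≡⟨ collect x₀ x q p ⟩
  - q * p + x₀                 ∎)
  where
  open ≡-Reasoning
  p = + suc m
  e = x₀ - x
  i = e %ℕ suc m
  q = e /ℕ suc m
  expand : ∀ i r x → i + x ≡ i + r - r + x
  expand = solve-∀
  collect : ∀ x₀ x q p → x₀ - x - q * p + x ≡ - q * p + x₀
  collect = solve-∀

periodic-bounded : ∀ {f} m → OrderPreserving f → Periodic (+ suc m) f →
                   ∀ x → (f 0ℤ - + suc m) + x ≤ᶻ f x × f x ≤ᶻ (f 0ℤ + + suc m) + x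
periodic-bounded {f} m mf per x with residue-offset m 0ℤ x
... | i , q , i≤m , x+i≡qp = lower , upper
  where
  open ≤-Reasoning
  p = + suc m
  x≤x+i : x ≤ᶻ + i + x
  x≤x+i = i≤j+i x (+ i)

  f[x+i] : f (+ i + x) ≡ + i + x + f 0ℤ
  f[x+i] = trans (cong f x+i≡qp) (trans (periodic-* {p} {f} per q 0ℤ)
                 (cong (_+ f 0ℤ) (trans (sym (+-identityʳ (q * p))) (sym x+i≡qp))))

  upper : f x ≤ᶻ (f 0ℤ + p) + x
  upper = begin
    f x                  ≤⟨ mf _ _ x≤x+i ⟩
    f (+ i + x)          ≡⟨ f[x+i] ⟩
    + i + x + f 0ℤ       ≤⟨ +-monoˡ-≤ (f 0ℤ) (+-monoˡ-≤ x (+≤+ (ℕ.m≤n⇒m≤1+n i≤m))) ⟩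
    p + x + f 0ℤ         ≡⟨ swap p x (f 0ℤ) ⟩
    (f 0ℤ + p) + x       ∎
    where
    swap : ∀ p x y → p + x + y ≡ (y + p) + x
    swap = solve-∀

  x+i-p≤x : - p + (+ i + x) ≤ᶻ x
  x+i-p≤x = begin
    - p + (+ i + x)      ≡⟨ regroup p (+ i) x ⟩
    (+ i - p) + x        ≤⟨ +-monoˡ-≤ x (i≤j⇒i-j≤0 (+≤+ (ℕ.m≤n⇒m≤1+n i≤m))) ⟩
    0ℤ + x               ≡⟨ +-identityˡ x ⟩
    x                    ∎
    where
    regroup : ∀ p i x → - p + (i + x) ≡ (i - p) + x
    regroup = solve-∀

  lower : (f 0ℤ - p) + x ≤ᶻ f x
  lower = begin
    (f 0ℤ - p) + x               ≤⟨ +-monoʳ-≤ (f 0ℤ - p) x≤x+i ⟩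
    (f 0ℤ - p) + (+ i + x)       ≡⟨ regroup (f 0ℤ) p (+ i + x) ⟩
    - p + (+ i + x + f 0ℤ)       ≡⟨ cong (_+_ (- p)) f[x+i] ⟨
    - p + f (+ i + x)            ≡⟨ periodic-neg {p} {f} per (+ i + x) ⟨
    f (- p + (+ i + x))          ≤⟨ mf _ _ x+i-p≤x ⟩
    f x                          ∎
    where
    regroup : ∀ y p z → (y - p) + z ≡ - p + (z + y)
    regroup = solve-∀

_≤̇_ : Fn n → Fn n → Set
f ≤̇ g = ∀ x → fun f x ≤ᶻ fun g x

translation-residual : ∀ c → IsResidual (_+_ c) (_+_ (- c))
translation-residual c b = ≤-reflexive (+-neg-cancel c b) ,
  λ a c+a≤b → subst (_≤ᶻ - c + b) (neg-+-cancel c a) (+-monoʳ-≤ (- c) c+a≤b)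

translation-dualResidual : ∀ c → IsDualResidual (_+_ c) (_+_ (- c))
translation-dualResidual c a = ≤-reflexive (sym (+-neg-cancel c a)) ,
  λ b a≤c+b → subst (- c + a ≤ᶻ_) (neg-+-cancel c b) (+-monoʳ-≤ (- c) a≤c+b)

negated-times : ℤ → ℕ → ℤ
negated-times c zero    = c
negated-times c (suc k) = - negated-times c k

translation : ℤ → Fn n
translation c = record
  { fun      = _+_ c
  ; mono     = λ _ _ → +-monoʳ-≤ c
  ; rs       = λ k → _+_ (negated-times c (suc k))
  ; ls       = λ k → _+_ (negated-times c (suc k))
  ; rs-res   = λ { zero    → translation-residual c
                 ; (suc k) → translation-residual (negated-times c (suc k)) }
  ; ls-res   = λ { zero    → translation-dualResidual c
                 ; (suc k) → translation-dualResidual (negated-times c (suc k)) }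
  ; balanced = λ _ → refl
  }

idₙ : Fn n
idₙ = translation 0ℤ

BinOp : Set
BinOp = (ℤ → ℤ) → (ℤ → ℤ) → ℤ → ℤ

-- Taking residuals exchanges op true and op false: (A ∘ B)^r = B^r ∘ A^r and (A ∨ B)^r = A^r ∧ B^r.
record ResiduatedPair : Set where
  field
    op          : Bool → BinOp
    op-mono     : ∀ b {A B} → OrderPreserving A → OrderPreserving B → OrderPreserving (op b A B)
    op-residual : ∀ b {A A′ B B′} → OrderPreserving A → OrderPreserving B →
                  IsResidual A A′ → IsResidual B B′ → IsResidual (op b A B) (op (not b) A′ B′)
    op-cong     : ∀ b {A A′ B B′} → A ≗ A′ → B ≗ B′ → op b A B ≗ op b A′ B′

  op-dualResidual : ∀ b {A A′ B B′} → OrderPreserving A → OrderPreserving B →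
                    IsDualResidual A A′ → IsDualResidual B B′ →
                    IsDualResidual (op b A B) (op (not b) A′ B′)
  op-dualResidual b {A} {A′} {B} {B′} mA mB dA dB =
    residual⇒dualResidual (op-mono (not b) mA′ mB′)
      (subst (λ b′ → IsResidual (op (not b) A′ B′) (op b′ A B)) (not-involutive b)
        (op-residual (not b) mA′ mB′ (dualResidual⇒residual mA dA) (dualResidual⇒residual mB dB)))
    where
    mA′ = dualResidual-mono dA
    mB′ = dualResidual-mono dB

even : ℕ → Bool
even zero    = true
even (suc k) = not (even k)

combine : ResiduatedPair → Fn n → Fn n → Fn n
combine {n} O F G = record
  { fun      = op true (fun F) (fun G)
  ; mono     = op-mono true (mono F) (mono G)
  ; rs       = rs′
  ; ls       = ls′
  ; rs-res   = rs′-res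
  ; ls-res   = ls′-res
  ; balanced = balanced′ n (balanced F) (balanced G)
  }
  where
  open ResiduatedPair O
  rs′ ls′ : ℕ → ℤ → ℤ
  rs′ k = op (even (suc k)) (rs F k) (rs G k)
  ls′ k = op (even (suc k)) (ls F k) (ls G k)

  rs′-res : ∀ k → IsResidual (iter (op true (fun F) (fun G)) rs′ k) (rs′ k)
  rs′-res zero    = op-residual true (mono F) (mono G) (rs-res F 0) (rs-res G 0)
  rs′-res (suc k) = op-residual (even (suc k)) (res^-mono F (suc k)) (res^-mono G (suc k))
                                (rs-res F (suc k)) (rs-res G (suc k))

  ls′-res : ∀ k → IsDualResidual (iter (op true (fun F) (fun G)) ls′ k) (ls′ k)
  ls′-res zero    = op-dualResidual true (mono F) (mono G) (ls-res F 0) (ls-res G 0)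
  ls′-res (suc k) = op-dualResidual (even (suc k))
                                    (dualResidual-mono (ls-res F k)) (dualResidual-mono (ls-res G k))
                                    (ls-res F (suc k)) (ls-res G (suc k))

  balanced′ : ∀ j → dual^ F j ≗ res^ F j → dual^ G j ≗ res^ G j →
              iter (op true (fun F) (fun G)) ls′ j ≗ iter (op true (fun F) (fun G)) rs′ j
  balanced′ zero    _   _   _ = refl
  balanced′ (suc j) F-eq G-eq = op-cong (even (suc j)) F-eq G-eq

∘-mono : OrderPreserving A → OrderPreserving B → OrderPreserving (λ x → A (B x))
∘-mono mA mB x y x≤y = mA _ _ (mB _ _ x≤y)

∘-residual : ∀ {A A′ B B′} → OrderPreserving A → IsResidual A A′ → IsResidual B B′ →
             IsResidual (λ x → A (B x)) (λ x → B′ (A′ x))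
∘-residual mA rA rB b =
  ≤-trans (mA _ _ (proj₁ (rB _))) (proj₁ (rA b)) , λ a ABa≤b → proj₂ (rB _) a (proj₂ (rA b) _ ABa≤b)

composeOrFlip : Bool → BinOp
composeOrFlip true  A B x = A (B x)
composeOrFlip false A B x = B (A x)

composition : ResiduatedPair
composition = record
  { op          = composeOrFlip
  ; op-mono     = λ { true mA mB → ∘-mono mA mB ; false mA mB → ∘-mono mB mA }
  ; op-residual = λ { true  mA mB rA rB → ∘-residual mA rA rB
                    ; false mA mB rA rB → ∘-residual mB rB rA }
  ; op-cong     = λ { true {A} A≗ B≗ x → trans (cong A (B≗ x)) (A≗ _)
                    ; false {B = B} A≗ B≗ x → trans (cong B (A≗ x)) (B≗ _) }
  }

_∘ₙ_ : Fn n → Fn n → Fn n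
_∘ₙ_ = combine composition

infixr 9 _∘ₙ_

⊔-residual : ∀ {A A′ B B′} → OrderPreserving A → OrderPreserving B →
             IsResidual A A′ → IsResidual B B′ → IsResidual (λ x → A x ⊔ B x) (λ x → A′ x ⊓ B′ x)
⊔-residual mA mB rA rB b =
  ⊔-lub (≤-trans (mA _ _ (i⊓j≤i _ _)) (proj₁ (rA b))) (≤-trans (mB _ _ (i⊓j≤j _ _)) (proj₁ (rB b))) ,
  λ a le → ⊓-glb (proj₂ (rA b) a (i⊔j≤k⇒i≤k _ _ le)) (proj₂ (rB b) a (i⊔j≤k⇒j≤k _ _ le))

⊓-residual : ∀ {A A′ B B′} → IsResidual A A′ → IsResidual B B′ →
             IsResidual (λ x → A x ⊓ B x) (λ x → A′ x ⊔ B′ x)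
⊓-residual {A} {A′} {B} {B′} rA rB b = counit , unit
  where
  counit : A (A′ b ⊔ B′ b) ⊓ B (A′ b ⊔ B′ b) ≤ᶻ b
  counit with ⊔-sel (A′ b) (B′ b)
  ... | inj₁ eq = subst (λ z → A z ⊓ B z ≤ᶻ b) (sym eq) (i≤j⇒i⊓k≤j _ (proj₁ (rA b)))
  ... | inj₂ eq = subst (λ z → A z ⊓ B z ≤ᶻ b) (sym eq) (i≤j⇒k⊓i≤j _ (proj₁ (rB b)))

  unit : ∀ a → A a ⊓ B a ≤ᶻ b → a ≤ᶻ A′ b ⊔ B′ b
  unit a le with ⊓-sel (A a) (B a)
  ... | inj₁ eq = i≤j⇒i≤j⊔k _ (proj₂ (rA b) a (subst (_≤ᶻ b) eq le))
  ... | inj₂ eq = i≤j⇒i≤k⊔j _ (proj₂ (rB b) a (subst (_≤ᶻ b) eq le))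

joinOrMeet : Bool → BinOp
joinOrMeet true  A B x = A x ⊔ B x
joinOrMeet false A B x = A x ⊓ B x

lattice : ResiduatedPair
lattice = record
  { op          = joinOrMeet
  ; op-mono     = λ { true mA mB x y x≤y → ⊔-mono-≤ (mA _ _ x≤y) (mB _ _ x≤y)
                    ; false mA mB x y x≤y → ⊓-mono-≤ (mA _ _ x≤y) (mB _ _ x≤y) }
  ; op-residual = λ { true  mA mB rA rB → ⊔-residual mA mB rA rB
                    ; false mA mB rA rB → ⊓-residual rA rB }
  ; op-cong     = λ { true  A≗ B≗ x → cong₂ _⊔_ (A≗ x) (B≗ x)
                    ; false A≗ B≗ x → cong₂ _⊓_ (A≗ x) (B≗ x) }
  }

infixr 6 _∨ₙ_

_∨ₙ_ : Fn n → Fn n → Fn n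
_∨ₙ_ = combine lattice

-- Needs n ≥ 1: the ℓ-chain of F^ℓ is that of F shifted up one level and its r-chain is shifted down one
-- level, so its balance at level n compares F^{ℓ^(n+1)} with F^{r^(n-1)}.
_ˡ : ∀ {m} → Fn (suc m) → Fn (suc m)
_ˡ {m} F = record
  { fun      = ls F 0
  ; mono     = dualResidual-mono (ls-res F 0)
  ; rs       = res^ F
  ; ls       = λ k → ls F (suc k)
  ; rs-res   = λ { zero    → dualResidual⇒residual (mono F) (ls-res F 0)
                 ; (suc k) → rs-res F k }
  ; ls-res   = λ { zero    → ls-res F 1
                 ; (suc k) → ls-res F (suc (suc k)) }
  ; balanced = dualResidual-unique (dualResidual-resp-≗ (balanced F) (ls-res F (suc m)))
                                   (residual⇒dualResidual (res^-mono F m) (rs-res F m))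
  }

module Simplicity {m : ℕ} (θ : Fn (suc m) → Fn (suc m) → Set) (θ-congruence : IsCongruence θ) where
  open IsCongruence θ-congruence

  private
    variable
      f f′ g g′ h : Fn (suc m)
    p : ℤ
    p = + suc m

  θ-refl : ∀ f → θ f f
  θ-refl f = reflexive f f (λ _ → refl)

  θ-respʳ-≈ : g ≈ g′ → θ f g → θ f g′
  θ-respʳ-≈ g≈g′ t = transitive _ _ _ t (reflexive _ _ g≈g′)

  θ-respˡ-≈ : f ≈ f′ → θ f g → θ f′ g
  θ-respˡ-≈ f≈f′ t = transitive _ _ _ (reflexive _ _ (λ x → sym (f≈f′ x))) t

  θ-∘ : θ f f′ → θ g g′ → θ (f ∘ₙ g) (f′ ∘ₙ g′)
  θ-∘ t u = compat-∘ _ _ _ _ _ _ t u (λ _ → refl) (λ _ → refl)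

  θ-∨ : θ f f′ → θ g g′ → θ (f ∨ₙ g) (f′ ∨ₙ g′)
  θ-∨ t u = compat-∨ _ _ _ _ _ _ t u (λ _ → refl) (λ _ → refl)

  -- θ-classes are convex: h = h ∨ f and g = h ∨ g.
  θ-between : θ f g → f ≤̇ h → h ≤̇ g → θ h g
  θ-between {f} {g} {h} t f≤h h≤g =
    compat-∨ h h f g h g (θ-refl h) t (λ x → sym (i≥j⇒i⊔j≡i (f≤h x))) (λ x → sym (i≤j⇒i⊔j≡j (h≤g x)))

  RaisesAt : ℤ → Set
  RaisesAt x₀ = ∃[ c ] θ c idₙ × 1ℤ + x₀ ≤ᶻ fun c x₀

  RaisesEverywhere : Set
  RaisesEverywhere = ∃[ d ] θ d idₙ × (∀ x → 1ℤ + x ≤ᶻ fun d x)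

  -- g^ℓ ∘ g ≤ id, while g^ℓ ∘ f lifts x₀ because f x₀ lies above g x₀.
  raise-at : ∀ x₀ → θ f g → fun g x₀ <ᶻ fun f x₀ → RaisesAt x₀
  raise-at {f} {g} x₀ t g<f =
    g ˡ ∘ₙ f ∨ₙ idₙ ,
    θ-respʳ-≈ cancels (θ-∨ (θ-∘ (θ-refl (g ˡ)) t) (θ-refl idₙ)) ,
    ≤-trans raised (i≤i⊔j _ _)
    where
    cancels : (g ˡ ∘ₙ g ∨ₙ idₙ) ≈ idₙ
    cancels x =
      i≤j⇒i⊔j≡j (≤-trans (proj₂ (ls-res g 0 (fun g x)) x ≤-refl) (≤-reflexive (sym (+-identityˡ x))))

    raised : 1ℤ + x₀ ≤ᶻ ls g 0 (fun f x₀)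
    raised = ≰⇒suc≤ λ gˡfx₀≤x₀ →
      <⇒≱ g<f (≤-trans (proj₁ (ls-res g 0 (fun f x₀))) (mono g _ _ gˡfx₀≤x₀))

  conjugate : ℤ → Fn (suc m) → Fn (suc m)
  conjugate i c = translation (- i) ∘ₙ c ∘ₙ translation i

  θ-conjugate : ∀ {c} i → θ c idₙ → θ (conjugate i c) idₙ
  θ-conjugate i t = θ-respʳ-≈ (undo i) (θ-∘ (θ-refl _) (θ-∘ t (θ-refl _)))
    where
    undo : ∀ i x → - i + (0ℤ + (i + x)) ≡ 0ℤ + x
    undo = solve-∀

  -- The conjugate of c by i raises the residue class of x₀ - i; the join over i = 0, …, m raises every class.
  spread : ∀ x₀ → RaisesAt x₀ → RaisesEverywhere
  spread x₀ (c , θc , raised) = conjugates m , θ-conjugates m , raises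
    where
    open ≤-Reasoning
    conjugates : ℕ → Fn (suc m)
    conjugates zero    = conjugate 0ℤ c
    conjugates (suc j) = conjugates j ∨ₙ conjugate (+ suc j) c

    θ-conjugates : ∀ j → θ (conjugates j) idₙ
    θ-conjugates zero    = θ-conjugate 0ℤ θc
    θ-conjugates (suc j) =
      θ-respʳ-≈ (λ _ → ⊔-idem _) (θ-∨ (θ-conjugates j) (θ-conjugate (+ suc j) θc))

    conjugate≤conjugates : ∀ {i j} → i ≤ j → conjugate (+ i) c ≤̇ conjugates j
    conjugate≤conjugates {j = zero} z≤n x = ≤-refl
    conjugate≤conjugates {i} {suc j} i≤1+j x with ℕ.m≤n⇒m<n∨m≡n i≤1+j
    ... | inj₁ i<1+j = ≤-trans (conjugate≤conjugates (s≤s⁻¹ i<1+j) x) (i≤i⊔j _ _)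
    ... | inj₂ refl  = i≤j⊔i _ _

    conjugate-raises : ∀ i q x → + i + x ≡ q * p + x₀ → 1ℤ + x ≤ᶻ fun (conjugate (+ i) c) x
    conjugate-raises i q x eq = begin
      1ℤ + x                           ≡⟨ insert (+ i) x ⟩
      - + i + (1ℤ + (+ i + x))         ≡⟨ cong (λ y → - + i + (1ℤ + y)) eq ⟩
      - + i + (1ℤ + (q * p + x₀))      ≡⟨ cong (_+_ (- + i)) (swap (q * p) x₀) ⟩
      - + i + (q * p + (1ℤ + x₀))      ≤⟨ +-monoʳ-≤ (- + i) (+-monoʳ-≤ (q * p) raised) ⟩
      - + i + (q * p + fun c x₀)       ≡⟨ cong (_+_ (- + i)) (c-periodic q x₀) ⟨
      - + i + fun c (q * p + x₀)       ≡⟨ cong (λ y → - + i + fun c y) eq ⟨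
      - + i + fun c (+ i + x)          ∎
      where
      insert : ∀ i x → 1ℤ + x ≡ - i + (1ℤ + (i + x))
      insert = solve-∀
      swap : ∀ a b → 1ℤ + (a + b) ≡ a + (1ℤ + b)
      swap = solve-∀
      c-periodic = periodic-* {p} {fun c} (Fn-periodic c)

    raises : ∀ x → 1ℤ + x ≤ᶻ fun (conjugates m) x
    raises x with residue-offset m x₀ x
    ... | i , q , i≤m , eq = ≤-trans (conjugate-raises i q x eq) (conjugate≤conjugates i≤m x)

  -- τ_k is squeezed between id and d^k; τ_{-k} is then θ-related to τ_{-k} ∘ τ_k = id.
  θ-translation : RaisesEverywhere → ∀ c → θ (translation c) idₙ
  θ-translation (d , θd , raises) = λ { (+ k) → upward k ; -[1+ k ] → downward (suc k) }
    where
    open ≤-Reasoning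
    power : ℕ → Fn (suc m)
    power zero    = idₙ
    power (suc k) = d ∘ₙ power k

    θ-power : ∀ k → θ (power k) idₙ
    θ-power zero    = θ-refl idₙ
    θ-power (suc k) = θ-respʳ-≈ (λ x → +-identityˡ (0ℤ + x)) (θ-∘ θd (θ-power k))

    translation≤power : ∀ k → translation (+ k) ≤̇ power k
    translation≤power zero    x = ≤-refl
    translation≤power (suc k) x = begin
      + suc k + x              ≡⟨ +-assoc 1ℤ (+ k) x ⟩
      1ℤ + (+ k + x)           ≤⟨ +-monoʳ-≤ 1ℤ (translation≤power k x) ⟩
      1ℤ + fun (power k) x     ≤⟨ raises _ ⟩
      fun d (fun (power k) x)  ∎

    upward : ∀ k → θ (translation (+ k)) idₙ
    upward k = transitive _ _ _ (θ-between (symmetric _ _ (θ-power k)) id≤τₖ (translation≤power k)) (θ-power k)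
      where
      id≤τₖ : idₙ {suc m} ≤̇ translation (+ k)
      id≤τₖ x = +-monoˡ-≤ x (+≤+ z≤n)

    downward : ∀ k → θ (translation (- + k)) idₙ
    downward k =
      symmetric _ _ (θ-respˡ-≈ inverse (θ-respʳ-≈ right-unit (θ-∘ (θ-refl (translation (- + k))) (upward k))))
      where
      inverse : (translation (- + k) ∘ₙ translation (+ k)) ≈ idₙ {suc m}
      inverse x = trans (neg-+-cancel (+ k) x) (sym (+-identityˡ x))
      right-unit : (translation (- + k) ∘ₙ idₙ) ≈ translation {suc m} (- + k)
      right-unit x = cong (_+_ (- + k)) (+-identityˡ x)

  θ-everything : RaisesEverywhere → ∀ h → θ h idₙ
  θ-everything raises h = transitive _ _ _
    (θ-between lower~upper (λ x → proj₁ (bounds x)) (λ x → proj₂ (bounds x))) (θ-translation raises _)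
    where
    bounds = periodic-bounded m (mono h) (Fn-periodic h)
    lower~upper : θ (translation (fun h 0ℤ - p)) (translation (fun h 0ℤ + p))
    lower~upper = transitive _ _ _ (θ-translation raises _) (symmetric _ _ (θ-translation raises _))

  separated⇒total : ∀ x → θ f g → fun f x ≢ fun g x → ∀ h h′ → θ h h′
  separated⇒total {f} {g} x t f≢g h h′ =
    transitive _ _ _ (θ-everything raises h) (symmetric _ _ (θ-everything raises h′))
    where
    raises : RaisesEverywhere
    raises with <-cmp (fun f x) (fun g x)
    ... | tri< f<g _ _ = spread x (raise-at x (symmetric _ _ t) f<g)
    ... | tri≈ _ f≡g _ = ⊥-elim (f≢g f≡g)
    ... | tri> _ _ g<f = spread x (raise-at x t g<f)

lemma2p10 : (n : ℕ) → 1 ≤ n → Simple n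
lemma2p10 (suc m) _ = (idₙ , translation 1ℤ , distinct) , dichotomy
  where
  distinct : ¬ (idₙ {suc m} ≈ translation 1ℤ)
  distinct id≈τ₁ with id≈τ₁ 0ℤ
  ... | ()

  dichotomy : ∀ θ → IsCongruence θ → ¬ ¬ ((∀ f g → θ f g → f ≈ g) ⊎ (∀ f g → θ f g))
  dichotomy θ θ-congruence neither = neither (inj₁ λ f g t x → pointwise f g t x)
    where
    open Simplicity θ θ-congruence
    pointwise : ∀ f g → θ f g → ∀ x → fun f x ≡ fun g x
    pointwise f g t x with fun f x ≟ fun g x
    ... | yes f≡g = f≡g
    ... | no f≢g  = ⊥-elim (neither (inj₂ (separated⇒total x t f≢g)))
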